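{- For all nonnegative integers $n$ and $r$, $${}_rF_{n+r}=r!\sum_{k=0}^{n}\binom{n}{k}r^{n-k}F_{k,r+1},$$ with the convention $0^0=1$.
   Context: $\left\{ {n \atop k}\right\}$ are Stirling numbers of the second kind; for $\beta>0$, $F_{n,\beta}=\frac{1}{\Gamma(\beta)}\sum_{k=0}^{n}\left\{ {n \atop k}\right\}\Gamma(k+\beta)$ (general geometric numbers). $\left\{ {n \atop k}\right\}_r$ are the $r$-Stirling numbers of the second kind (partitions of $\{1,\dots,n\}$ into $k$ nonempty blocks with $1,\dots,r$ in distinct blocks), and the $r$-geometric numbers are ${}_rF_n=\sum_{k=0}^{n}\left\{ {n \atop k}\right\}_r k!$. -}

module Defs where

open import Data.Nat using (ℕ; zero; suc; _+_; _*_; _∸_; _^_; _<ᵇ_; _≡ᵇ_)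
open import Data.Nat.Combinatorics using (_C_)
open import Data.Nat.Base using (_!)
open import Data.Bool using (if_then_else_)

sumTo : ℕ → (ℕ → ℕ) → ℕ
sumTo zero    f = f 0
sumTo (suc n) f = sumTo n f + f (suc n)

stirling2 : ℕ → ℕ → ℕ
stirling2 zero    zero    = 1
stirling2 zero    (suc k) = 0
stirling2 (suc n) zero    = 0
stirling2 (suc n) (suc k) = suc k * stirling2 n (suc k) + stirling2 n k

rising : ℕ → ℕ → ℕ
rising x zero    = 1
rising x (suc j) = rising x j * (x + j)

-- general geometric number F_{n,β} = (1/Γ(β)) Σ_k S(n,k) Γ(k+β),
-- for positive integer β, where Γ(k+β)/Γ(β) = rising β k
F : ℕ → ℕ → ℕ
F n β = sumTo n (λ k → stirling2 n k * rising β k)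

-- auxiliary: rS r m k = {m+r ↔ k}_r
rS : ℕ → ℕ → ℕ → ℕ
rS r zero    k       = if k ≡ᵇ r then 1 else 0
rS r (suc m) zero    = 0
rS r (suc m) (suc k) = suc k * rS r m (suc k) + rS r m k

-- r-Stirling numbers of the second kind {n ↔ k}_r (Broder's recurrence;
-- zero for n < r, {r ↔ k}_r = [k = r])
rStirling2 : ℕ → ℕ → ℕ → ℕ
rStirling2 r n k = if n <ᵇ r then 0 else rS r (n ∸ r) k

rF : ℕ → ℕ → ℕ
rF r n = sumTo n (λ k → rStirling2 r n k * k !)

module Submission where

-- Everything is expressed through the weighted forward operator
--     (D a v)(i) = a(i)·v(i) + v(i+1)
-- on sequences v : ℕ → ℕ.  A triangle T(m,k) obeying the recurrence
--     T(m+1,k+1) = a(k+1)·T(m,k+1) + T(m,k),   T(m+1,0) = a(0)·T(m,0),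
-- whose row 0 is the indicator of a column c, satisfies the expansion
--     Σ_k T(m,k)·v(k) = (D aᵐ v)(c),
-- because each use of the recurrence moves one factor D a onto v.  Three such
-- triangles occur: the Stirling numbers S(m,k) (a(k) = k, c = 0), the
-- r-Stirling numbers {m+r,k}_r (a(k) = k, c = r) and the weighted binomials
-- C(m,k)·s^(m-k) (a constant = s, c = 0).  Translating a sequence by s turns
-- D id into D id + s; consequently (D idⁿ w)(s) is the binomial sum applied
-- to the sequence j ↦ (D idʲ (w(·+s)))(0).  For w = (_!) and s = r the left
-- side becomes the r-Stirling sum rF_{n+r}, and the Stirling expansion
-- identifies (D idʲ ((·+r)!))(0) with r!·F_{j,r+1}.

open import Defs
open import Data.Nat using (ℕ; _+_; _*_; _∸_; _^_)
open import Data.Nat.Base using (_!)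
open import Data.Nat.Combinatorics using (_C_)
open import Relation.Binary.PropositionalEquality using (_≡_)

open import Data.Nat.Base using (zero; suc; _<_; s≤s; _≡ᵇ_; _<ᵇ_)
open import Data.Nat.Properties
  using ( +-assoc; +-comm; +-identityʳ; *-identityˡ; *-identityʳ; *-zeroʳ; *-assoc; *-comm
        ; *-distribˡ-+; *-distribʳ-+; +-commutativeSemigroup; *-commutativeSemigroup
        ; ≡ᵇ⇒≡; ≡⇒≡ᵇ; <ᵇ⇒<; <⇒≱; <⇒≢; >⇒≢; ≰⇒>; _≤?_
        ; m≤n+m; m+n∸n≡m; m<n⇒m<1+n; n<1+n; +-∸-assoc )
open import Data.Nat.Combinatorics using (k>n⇒nCk≡0; nCk+nC[k+1]≡[n+1]C[k+1])
open import Data.Nat.Tactic.RingSolver using (solve-∀)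
open import Algebra.Properties.CommutativeSemigroup +-commutativeSemigroup
  using (interchange)
open import Algebra.Properties.CommutativeSemigroup *-commutativeSemigroup
  using () renaming (x∙yz≈y∙xz to *-exchange)
open import Data.Bool using (true; false)
open import Data.Empty using (⊥-elim)
open import Function using (id; const)
open import Relation.Nullary using (yes; no)
open import Relation.Binary.PropositionalEquality
  using (_≢_; refl; sym; trans; cong; cong₂; module ≡-Reasoning)
open ≡-Reasoning

sumTo-cong : ∀ n {f g : ℕ → ℕ} → (∀ k → f k ≡ g k) → sumTo n f ≡ sumTo n g
sumTo-cong zero    f≡g = f≡g 0
sumTo-cong (suc n) f≡g = cong₂ _+_ (sumTo-cong n f≡g) (f≡g (suc n))

sumTo-head : ∀ n (f : ℕ → ℕ) → sumTo (suc n) f ≡ f 0 + sumTo n (λ k → f (suc k))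
sumTo-head zero    f = refl
sumTo-head (suc n) f =
  trans (cong (_+ f (suc (suc n))) (sumTo-head n f)) (+-assoc (f 0) _ _)

sumTo-+ : ∀ n (f g : ℕ → ℕ) → sumTo n (λ k → f k + g k) ≡ sumTo n f + sumTo n g
sumTo-+ zero    f g = refl
sumTo-+ (suc n) f g =
  trans (cong (_+ (f (suc n) + g (suc n))) (sumTo-+ n f g))
        (interchange (sumTo n f) (sumTo n g) (f (suc n)) (g (suc n)))

sumTo-* : ∀ n c (f : ℕ → ℕ) → sumTo n (λ k → c * f k) ≡ c * sumTo n f
sumTo-* zero    c f = refl
sumTo-* (suc n) c f =
  trans (cong (_+ c * f (suc n)) (sumTo-* n c f)) (sym (*-distribˡ-+ c _ _))

sumTo-top : ∀ n (f : ℕ → ℕ) → (∀ k → k < n → f k ≡ 0) → sumTo n f ≡ f n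
sumTo-top zero    f _     = refl
sumTo-top (suc n) f below = cong (_+ f (suc n)) (trans
  (sumTo-top n f (λ k k<n → below k (m<n⇒m<1+n k<n)))
  (below n (n<1+n n)))

D : (ℕ → ℕ) → (ℕ → ℕ) → (ℕ → ℕ)
D a v i = a i * v i + v (suc i)

Dⁿ : (ℕ → ℕ) → ℕ → (ℕ → ℕ) → (ℕ → ℕ)
Dⁿ a zero    v = v
Dⁿ a (suc m) v = Dⁿ a m (D a v)

Dⁿ-cong : ∀ a m {f g : ℕ → ℕ} → (∀ i → f i ≡ g i) →
          ∀ i → Dⁿ a m f i ≡ Dⁿ a m g i
Dⁿ-cong a zero    f≡g = f≡g
Dⁿ-cong a (suc m) f≡g =
  Dⁿ-cong a m (λ i → cong₂ _+_ (cong (a i *_) (f≡g i)) (f≡g (suc i)))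

Dⁿ-+ : ∀ a m (f g : ℕ → ℕ) i → Dⁿ a m (λ x → f x + g x) i ≡ Dⁿ a m f i + Dⁿ a m g i
Dⁿ-+ a zero    f g i = refl
Dⁿ-+ a (suc m) f g i = trans
  (Dⁿ-cong a m (λ x → D-additive (a x) (f x) (g x) (f (suc x)) (g (suc x))) i)
  (Dⁿ-+ a m (D a f) (D a g) i)
  where
  D-additive : ∀ α x y x′ y′ → α * (x + y) + (x′ + y′) ≡ (α * x + x′) + (α * y + y′)
  D-additive = solve-∀

Dⁿ-* : ∀ a m c (f : ℕ → ℕ) i → Dⁿ a m (λ x → c * f x) i ≡ c * Dⁿ a m f i
Dⁿ-* a zero    c f i = refl
Dⁿ-* a (suc m) c f i = trans
  (Dⁿ-cong a m (λ x → D-homogeneous (a x) c (f x) (f (suc x))) i)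
  (Dⁿ-* a m c (D a f) i)
  where
  D-homogeneous : ∀ α c x x′ → α * (c * x) + c * x′ ≡ c * (α * x + x′)
  D-homogeneous = solve-∀

record StirlingTriangle (a : ℕ → ℕ) (c : ℕ) (T : ℕ → ℕ → ℕ) : Set where
  field
    rec-zero : ∀ m → T (suc m) 0 ≡ a 0 * T m 0
    rec-suc  : ∀ m k → T (suc m) (suc k) ≡ a (suc k) * T m (suc k) + T m k
    apex     : T 0 c ≡ 1
    off-apex : ∀ k → k ≢ c → T 0 k ≡ 0

module Expansion {a c T} (triangle : StirlingTriangle a c T) where
  open StirlingTriangle triangle

  vanish : ∀ m k → m + c < k → T m k ≡ 0
  vanish zero    k       c<k           = off-apex k (>⇒≢ c<k)
  vanish (suc m) (suc k) (s≤s m+c<k) = begin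
    T (suc m) (suc k)                ≡⟨ rec-suc m k ⟩
    a (suc k) * T m (suc k) + T m k  ≡⟨ cong₂ (λ x y → a (suc k) * x + y)
                                          (vanish m (suc k) (m<n⇒m<1+n m+c<k))
                                          (vanish m k m+c<k) ⟩
    a (suc k) * 0 + 0                ≡⟨ +-identityʳ _ ⟩
    a (suc k) * 0                    ≡⟨ *-zeroʳ (a (suc k)) ⟩
    0                                ∎

  -- One use of the recurrence moves one factor D a from the triangle onto v.
  transfer-step : ∀ m (v : ℕ → ℕ) →
    sumTo (suc (m + c)) (λ k → T (suc m) k * v k) ≡ sumTo (m + c) (λ k → T m k * D a v k)
  transfer-step m v = begin
    sumTo (suc N) (λ k → T (suc m) k * v k)
      ≡⟨ sumTo-head N _ ⟩
    T (suc m) 0 * v 0 + sumTo N (λ k → T (suc m) (suc k) * v (suc k))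
      ≡⟨ cong₂ _+_ (cong (_* v 0) (rec-zero m)) (sumTo-cong N split) ⟩
    g 0 + sumTo N (λ k → g (suc k) + h k)
      ≡⟨ cong (g 0 +_) (sumTo-+ N (λ k → g (suc k)) h) ⟩
    g 0 + (sumTo N (λ k → g (suc k)) + sumTo N h)
      ≡⟨ sym (+-assoc (g 0) _ _) ⟩
    (g 0 + sumTo N (λ k → g (suc k))) + sumTo N h
      ≡⟨ cong (_+ sumTo N h) (sym (sumTo-head N g)) ⟩
    (sumTo N g + g (suc N)) + sumTo N h
      ≡⟨ cong (λ x → (sumTo N g + x) + sumTo N h) g-top ⟩
    (sumTo N g + 0) + sumTo N h
      ≡⟨ cong (_+ sumTo N h) (+-identityʳ _) ⟩
    sumTo N g + sumTo N h
      ≡⟨ sym (sumTo-+ N g h) ⟩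
    sumTo N (λ k → g k + h k)
      ≡⟨ sumTo-cong N (λ k → merge (a k) (T m k) (v k) (v (suc k))) ⟩
    sumTo N (λ k → T m k * D a v k) ∎
    where
    N : ℕ
    N = m + c
    g h : ℕ → ℕ
    g k = a k * T m k * v k
    h k = T m k * v (suc k)
    split : ∀ k → T (suc m) (suc k) * v (suc k) ≡ g (suc k) + h k
    split k = trans (cong (_* v (suc k)) (rec-suc m k))
                    (*-distribʳ-+ (v (suc k)) (a (suc k) * T m (suc k)) (T m k))
    g-top : g (suc N) ≡ 0
    g-top = trans (cong (λ t → a (suc N) * t * v (suc N)) (vanish m (suc N) (n<1+n N)))
                  (cong (_* v (suc N)) (*-zeroʳ (a (suc N))))
    merge : ∀ α t x y → α * t * x + t * y ≡ t * (α * x + y)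
    merge = solve-∀

  transfer : ∀ m (v : ℕ → ℕ) →
    sumTo (m + c) (λ k → T m k * v k) ≡ sumTo c (λ k → T 0 k * Dⁿ a m v k)
  transfer zero    v = refl
  transfer (suc m) v = trans (transfer-step m v) (transfer m (D a v))

  expansion : ∀ m (v : ℕ → ℕ) → sumTo (m + c) (λ k → T m k * v k) ≡ Dⁿ a m v c
  expansion m v = begin
    sumTo (m + c) (λ k → T m k * v k)   ≡⟨ transfer m v ⟩
    sumTo c (λ k → T 0 k * Dⁿ a m v k)  ≡⟨ sumTo-top c _ below-apex ⟩
    T 0 c * Dⁿ a m v c                  ≡⟨ cong (_* Dⁿ a m v c) apex ⟩
    1 * Dⁿ a m v c                      ≡⟨ *-identityˡ _ ⟩
    Dⁿ a m v c                          ∎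
    where
    below-apex : ∀ k → k < c → T 0 k * Dⁿ a m v k ≡ 0
    below-apex k k<c = cong (_* Dⁿ a m v k) (off-apex k (<⇒≢ k<c))

stirling2-triangle : StirlingTriangle id 0 stirling2
stirling2-triangle = record
  { rec-zero = λ _ → refl ; rec-suc = λ _ _ → refl ; apex = refl ; off-apex = off-apex }
  where
  off-apex : ∀ k → k ≢ 0 → stirling2 0 k ≡ 0
  off-apex zero    k≢0 = ⊥-elim (k≢0 refl)
  off-apex (suc k) _   = refl

stirling2-expansion : ∀ m (v : ℕ → ℕ) → sumTo m (λ k → stirling2 m k * v k) ≡ Dⁿ id m v 0
stirling2-expansion m v = trans
  (cong (λ N → sumTo N (λ k → stirling2 m k * v k)) (sym (+-identityʳ m)))
  (Expansion.expansion stirling2-triangle m v)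

rS-triangle : ∀ r → StirlingTriangle id r (rS r)
rS-triangle r = record
  { rec-zero = λ _ → refl ; rec-suc = λ _ _ → refl ; apex = apex ; off-apex = off-apex }
  where
  apex : rS r 0 r ≡ 1
  apex with r ≡ᵇ r | ≡⇒≡ᵇ r r refl
  ... | true  | _  = refl
  ... | false | ()
  off-apex : ∀ k → k ≢ r → rS r 0 k ≡ 0
  off-apex k k≢r with k ≡ᵇ r | ≡ᵇ⇒≡ k r
  ... | true  | k≡r = ⊥-elim (k≢r (k≡r _))
  ... | false | _   = refl

rS-expansion : ∀ r m (w : ℕ → ℕ) → sumTo (m + r) (λ k → rS r m k * w k) ≡ Dⁿ id m w r
rS-expansion r = Expansion.expansion (rS-triangle r)

rStirling2-shift : ∀ r n k → rStirling2 r (n + r) k ≡ rS r n k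
rStirling2-shift r n k with n + r <ᵇ r | <ᵇ⇒< (n + r) r
... | true  | n+r<r = ⊥-elim (<⇒≱ (n+r<r _) (m≤n+m r n))
... | false | _     = cong (λ m → rS r m k) (m+n∸n≡m n r)

binomial : ℕ → ℕ → ℕ → ℕ
binomial s m k = (m C k) * s ^ (m ∸ k)

-- s·C(m,k)·s^(m-k) = C(m,k)·s^(m+1-k); for k > m both sides vanish.
binomial-scale : ∀ s m k → s * binomial s m k ≡ (m C k) * s ^ (suc m ∸ k)
binomial-scale s m k with k ≤? m
... | yes k≤m = trans (*-exchange s (m C k) (s ^ (m ∸ k)))
                      (cong (λ e → (m C k) * s ^ e) (sym (+-∸-assoc 1 k≤m)))
... | no  k≰m rewrite k>n⇒nCk≡0 (≰⇒> k≰m) = *-zeroʳ s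

binomial-triangle : ∀ s → StirlingTriangle (const s) 0 (binomial s)
binomial-triangle s = record
  { rec-zero = λ m → sym (binomial-scale s m 0)
  ; rec-suc  = pascal
  ; apex     = refl
  ; off-apex = off-apex
  }
  where
  pascal : ∀ m k → binomial s (suc m) (suc k) ≡ s * binomial s m (suc k) + binomial s m k
  pascal m k = begin
    (suc m C suc k) * s ^ (m ∸ k)
      ≡⟨ cong (_* s ^ (m ∸ k)) (sym (nCk+nC[k+1]≡[n+1]C[k+1] m k)) ⟩
    ((m C k) + (m C suc k)) * s ^ (m ∸ k)
      ≡⟨ *-distribʳ-+ (s ^ (m ∸ k)) (m C k) (m C suc k) ⟩
    binomial s m k + (m C suc k) * s ^ (m ∸ k)
      ≡⟨ +-comm (binomial s m k) _ ⟩
    (m C suc k) * s ^ (m ∸ k) + binomial s m k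
      ≡⟨ cong (_+ binomial s m k) (sym (binomial-scale s m (suc k))) ⟩
    s * binomial s m (suc k) + binomial s m k ∎
  off-apex : ∀ k → k ≢ 0 → binomial s 0 k ≡ 0
  off-apex zero    k≢0 = ⊥-elim (k≢0 refl)
  off-apex (suc k) _   = refl

binomial-expansion : ∀ s n (X : ℕ → ℕ) →
  sumTo n (λ j → binomial s n j * X j) ≡ Dⁿ (const s) n X 0
binomial-expansion s n X = trans
  (cong (λ N → sumTo N (λ j → binomial s n j * X j)) (sym (+-identityʳ n)))
  (Expansion.expansion (binomial-triangle s) n X)

iterates₀ : (ℕ → ℕ) → (ℕ → ℕ)
iterates₀ u j = Dⁿ id j u 0

-- Translation by s turns D id into D id + s, so it intertwines D id on
-- sequences with D (const s) on their sequences of iterates at 0.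
shift-intertwines : ∀ s (w : ℕ → ℕ) j →
  iterates₀ (λ i → D id w (i + s)) j ≡ D (const s) (iterates₀ (λ i → w (i + s))) j
shift-intertwines s w j = begin
  Dⁿ id j (λ i → D id w (i + s)) 0
    ≡⟨ Dⁿ-cong id j (λ i → translate i s (u i) (u (suc i))) 0 ⟩
  Dⁿ id j (λ i → D id u i + s * u i) 0
    ≡⟨ Dⁿ-+ id j (D id u) (λ i → s * u i) 0 ⟩
  iterates₀ u (suc j) + Dⁿ id j (λ i → s * u i) 0
    ≡⟨ cong (iterates₀ u (suc j) +_) (Dⁿ-* id j s u 0) ⟩
  iterates₀ u (suc j) + s * iterates₀ u j
    ≡⟨ +-comm (iterates₀ u (suc j)) _ ⟩
  s * iterates₀ u j + iterates₀ u (suc j) ∎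
  where
  u : ℕ → ℕ
  u i = w (i + s)
  translate : ∀ i s x y → (i + s) * x + y ≡ (i * x + y) + s * x
  translate = solve-∀

shift-iterate : ∀ s n (w : ℕ → ℕ) i →
  Dⁿ (const s) n (iterates₀ (λ x → w (x + s))) i ≡ iterates₀ (λ x → Dⁿ id n w (x + s)) i
shift-iterate s zero    w i = refl
shift-iterate s (suc n) w i = trans
  (Dⁿ-cong (const s) n (λ j → sym (shift-intertwines s w j)) i)
  (shift-iterate s n (D id w) i)

factorial-rising : ∀ r i → r ! * rising (r + 1) i ≡ (i + r) !
factorial-rising r zero    = *-identityʳ (r !)
factorial-rising r (suc i) = begin
  r ! * (rising (r + 1) i * (r + 1 + i))  ≡⟨ sym (*-assoc (r !) _ _) ⟩
  r ! * rising (r + 1) i * (r + 1 + i)    ≡⟨ cong₂ _*_ (factorial-rising r i) r+1+i≡1+i+r ⟩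
  (i + r) ! * suc (i + r)                 ≡⟨ *-comm ((i + r) !) _ ⟩
  suc (i + r) * (i + r) !                 ∎
  where
  r+1+i≡1+i+r : r + 1 + i ≡ suc (i + r)
  r+1+i≡1+i+r = trans (cong (_+ i) (+-comm r 1)) (cong suc (+-comm r i))

factorial-F : ∀ r j → r ! * F j (r + 1) ≡ iterates₀ (λ i → (i + r) !) j
factorial-F r j = begin
  r ! * sumTo j (λ i → stirling2 j i * rising (r + 1) i)    ≡⟨ sym (sumTo-* j (r !) _) ⟩
  sumTo j (λ i → r ! * (stirling2 j i * rising (r + 1) i))  ≡⟨ sumTo-cong j absorb ⟩
  sumTo j (λ i → stirling2 j i * (i + r) !)                 ≡⟨ stirling2-expansion j _ ⟩
  iterates₀ (λ i → (i + r) !) j                             ∎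
  where
  absorb : ∀ i → r ! * (stirling2 j i * rising (r + 1) i) ≡ stirling2 j i * (i + r) !
  absorb i = trans (*-exchange (r !) (stirling2 j i) _) (cong (stirling2 j i *_) (factorial-rising r i))

mainTheorem8 : (n r : ℕ) →
    rF r (n + r) ≡ r ! * sumTo n (λ k → (n C k) * (r ^ (n ∸ k)) * F k (r + 1))
mainTheorem8 n r = begin
  rF r (n + r)
    ≡⟨ sumTo-cong (n + r) (λ k → cong (_* k !) (rStirling2-shift r n k)) ⟩
  sumTo (n + r) (λ k → rS r n k * k !)
    ≡⟨ rS-expansion r n _! ⟩
  Dⁿ id n _! r
    ≡⟨ sym (shift-iterate r n _! 0) ⟩
  Dⁿ (const r) n Y 0
    ≡⟨ sym (binomial-expansion r n Y) ⟩
  sumTo n (λ k → binomial r n k * Y k)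
    ≡⟨ sumTo-cong n (λ k → cong (binomial r n k *_) (sym (factorial-F r k))) ⟩
  sumTo n (λ k → binomial r n k * (r ! * F k (r + 1)))
    ≡⟨ sumTo-cong n (λ k → *-exchange (binomial r n k) (r !) _) ⟩
  sumTo n (λ k → r ! * (binomial r n k * F k (r + 1)))
    ≡⟨ sumTo-* n (r !) _ ⟩
  r ! * sumTo n (λ k → (n C k) * (r ^ (n ∸ k)) * F k (r + 1)) ∎
  where
  -- the sequence j ↦ r!·F_{j,r+1}, in operator form
  Y : ℕ → ℕ
  Y = iterates₀ (λ i → (i + r) !)
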